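{- For every prime $p$, every primitive root $g$ modulo $p$ ($g=1$ if $p=2$) and every $d\in\mathbb{Z}/(p-1)\mathbb{Z}$, the Toeplitz word $\mathrm{T}(\lambda_{p,g}\,\rho_d)$ over the alphabet $\mathbb{Z}/(p-1)\mathbb{Z}$ is completely additive.
   Context: Here the alphabet is the cyclic group $\Sigma=\mathbb{Z}/(p-1)\mathbb{Z}$; gaps are bijections of $\Sigma$, $?$ the identity, $\rho_d$ the bijection $x\mapsto x+d$. For odd $p$, $\lambda_{p,g}=\log_g(1)\log_g(2)\cdots\log_g(p-1)$ with $\log_g(a)\in\{0,\dots,p-2\}$ the unique $e$ with $g^e\equiv a\pmod p$; $\lambda_{2,1}=0$. For words $x,y$: $(a\,x)\langle y\rangle=a\,x\langle y\rangle$, $(f\,x)\langle b\,y\rangle=f(b)\,x\langle y\rangle$, $(f\,x)\langle g\,y\rangle=(f\circ g)\,x\langle y\rangle$. For a pattern $P$ with first symbol in $\Sigma$: $T_0=?^\omega$, $T_{i+1}=P^\omega\langle T_i\rangle$, $\mathrm{T}(P)=\lim T_i$, indexed by positive integers. Completely additive: $\sigma(1)=0$, $\sigma(nm)=\sigma(n)+\sigma(m)$. -}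

module Defs where

open import Data.Nat using (ℕ; zero; suc; _+_; _*_; _∸_; _^_; _≤_; _<_; _≡ᵇ_)
open import Data.Nat.DivMod using (_%_; _mod_)
open import Data.Fin using (Fin; toℕ)
open import Data.List using (List; []; _∷_; _++_; map; allFin; length; lookup; findᵇ)
open import Data.Maybe using (fromMaybe)
open import Data.Product using (_×_; ∃)
open import Relation.Nullary using (¬_)
open import Relation.Binary.PropositionalEquality using (_≡_)
open import Function using (id; _∘_)

-- residue of a modulo p (for p = 0 just a itself; only prime p is used)
modN : ℕ → ℕ → ℕ
modN a zero    = a
modN a (suc q) = a % suc q

CongMod : ℕ → ℕ → ℕ → Set
CongMod p a b = modN a p ≡ modN b p

IsPrimitiveRoot : ℕ → ℕ → Set
IsPrimitiveRoot p g =
  CongMod p (g ^ (p ∸ 1)) 1 ×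
  (∀ e → 0 < e → e < p ∸ 1 → ¬ CongMod p (g ^ e) 1)

_⊕_ : ∀ {m} → Fin m → Fin m → Fin m
_⊕_ {suc m} a b = (toℕ a + toℕ b) mod suc m

ρ : ∀ {m} → Fin m → Fin m → Fin m
ρ d x = x ⊕ d

-- Symbols: letters of Σ, or gaps (bijections of Σ, represented by their
-- underlying functions; all gaps occurring here are bijections)
data Sym (m : ℕ) : Set where
  letter : Fin m → Sym m
  gap    : (Fin m → Fin m) → Sym m

-- infinite words, indexed from 0 internally
Word : ℕ → Set
Word m = ℕ → Sym m

isGap : ∀ {m} → Sym m → ℕ
isGap (letter _) = 0
isGap (gap _)    = 1

gapCount : ∀ {m} → Word m → ℕ → ℕ
gapCount x zero    = 0
gapCount x (suc n) = gapCount x n + isGap (x n)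

plug : ∀ {m} → (Fin m → Fin m) → Sym m → Sym m
plug f (letter b) = letter (f b)
plug f (gap g)    = gap (f ∘ g)

-- x⟨y⟩ : the k-th gap of x (counting from 0) is filled with y k
_⟨_⟩ : ∀ {m} → Word m → Word m → Word m
(x ⟨ y ⟩) n with x n
... | letter a = letter a
... | gap f    = plug f (y (gapCount x n))

-- P^ω for a finite pattern P (the empty pattern is never used)
_ω : ∀ {m} → List (Sym m) → Word m
([] ω) n       = gap id
((s ∷ P) ω) n  = lookup (s ∷ P) (n mod suc (length P))

Tseq : ∀ {m} → List (Sym m) → ℕ → Word m
Tseq P zero    = λ _ → gap id
Tseq P (suc i) = (P ω) ⟨ Tseq P i ⟩

-- w (indexed by positive integers; w 0 is irrelevant) is T(P) = lim T_i:
-- at each position n ≥ 1 the sequence T_i eventually equals the letter w n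
-- (position n corresponds to internal index n - 1)
IsToeplitzWord : ∀ {m} → List (Sym m) → (ℕ → Fin m) → Set
IsToeplitzWord P w =
  ∀ n → 1 ≤ n → ∃ λ i₀ → ∀ i → i₀ ≤ i → Tseq P i (n ∸ 1) ≡ letter (w n)

-- log_g(a) : the e ∈ {0,…,p-2} with g^e ≡ a (mod p), found by search;
-- `def` is returned if no such e exists (never happens for primitive g)
dlog : (p g a : ℕ) → Fin (p ∸ 1) → Fin (p ∸ 1)
dlog p g a def =
  fromMaybe def (findᵇ (λ e → modN (g ^ toℕ e) p ≡ᵇ modN a p) (allFin (p ∸ 1)))

lambdaWord : (p g : ℕ) → List (Sym (p ∸ 1))
lambdaWord p g = map (λ i → letter (dlog p g (suc (toℕ i)) i)) (allFin (p ∸ 1))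

pattern-λρ : (p g : ℕ) → Fin (p ∸ 1) → List (Sym (p ∸ 1))
pattern-λρ p g d = lambdaWord p g ++ (gap (ρ d) ∷ [])

CompletelyAdditive : ∀ {m} → (ℕ → Fin m) → Set
CompletelyAdditive σ =
  (toℕ (σ 1) ≡ 0) ×
  (∀ n k → 1 ≤ n → 1 ≤ k → σ (n * k) ≡ σ n ⊕ σ k)

-- Write m = p - 1.  The pattern λ_{p,g} ρ_d has period p: its positions
-- 0, …, m - 1 carry the letters log_g 1, …, log_g m and its last position is
-- the gap ρ_d.  Unfolding the definition of T(P) yields two recurrences for
-- w = T(λ_{p,g} ρ_d):
--   w(n)           is a discrete logarithm of n   whenever p ∤ n,
--   w(p (t + 1)) = w(t + 1) + d.
-- Any σ : ℕ → ℤ/mℤ satisfying these is completely additive: by induction on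
-- n + k, a factor p in n or k is peeled off with the second recurrence, and
-- if p divides neither n nor k then, by Euclid's lemma, σ(n k) and
-- σ(n) + σ(k) are both discrete logarithms of n k, hence equal.
module Submission where

open import Defs
open import Level using (0ℓ)
open import Data.Bool using (Bool; true; false; T)
open import Data.Fin using (Fin; toℕ; zero; suc; fromℕ<; punchOut)
open import Data.Fin.Properties
  using (toℕ-injective; toℕ<n; toℕ-fromℕ<; injective⇒≤; punchOut-injective; any?)
  renaming (_≟_ to _≟ᶠ_)
open import Data.List using (List; []; _∷_; _++_; map; allFin; length; lookup; findᵇ; tabulate)
open import Data.List.Properties using (length-++; length-map; length-tabulate)
open import Data.List.Membership.Propositional using (_∈_)
open import Data.List.Membership.Propositional.Properties using (∈-allFin)
open import Data.List.Relation.Unary.Any using (here; there)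
open import Data.Maybe using (fromMaybe)
open import Data.Nat using (ℕ; zero; suc; _+_; _*_; _∸_; _^_; _≤_; _<_; z≤n; s≤s; s≤s⁻¹; _≡ᵇ_; NonZero)
open import Data.Nat.Properties
open import Data.Nat.DivMod
open import Data.Nat.Divisibility using (_∣_; divides; _∣?_; _∣0; ∣1⇒≡1)
open import Data.Nat.Induction using (<-rec)
open import Data.Nat.Primality using (Prime; euclidsLemma; ¬prime[0]; ¬prime[1])
open import Data.Product using (_×_; ∃; _,_; proj₁; proj₂)
open import Data.Sum using (_⊎_; inj₁; inj₂; [_,_]′)
open import Function using (id; _∘_)
open import Function.Definitions using (Injective)
open import Relation.Binary using (Setoid; tri<; tri≈; tri>)
open import Relation.Nullary using (¬_; yes; no; contradiction)
open import Relation.Binary.PropositionalEquality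
import Relation.Binary.Reasoning.Setoid as SetoidReasoning

module Residues (n : ℕ) .{{_ : NonZero n}} where

  -- x ≋ y: x and y are congruent modulo n.  A record rather than a bare
  -- equation of residues, so that x and y are inferable from a proof.
  infix 4 _≋_
  record _≋_ (x y : ℕ) : Set where
    constructor mk≋
    field residue : x % n ≡ y % n
  open _≋_ public

  ≋-refl : ∀ {x} → x ≋ x
  ≋-refl = mk≋ refl

  ≋-sym : ∀ {x y} → x ≋ y → y ≋ x
  ≋-sym (mk≋ e) = mk≋ (sym e)

  ≋-trans : ∀ {x y z} → x ≋ y → y ≋ z → x ≋ z
  ≋-trans (mk≋ e) (mk≋ e′) = mk≋ (trans e e′)

  ≋-setoid : Setoid 0ℓ 0ℓ
  ≋-setoid = record
    { Carrier       = ℕ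
    ; _≈_           = _≋_
    ; isEquivalence = record { refl = ≋-refl ; sym = ≋-sym ; trans = ≋-trans }
    }

  module ≋-Reasoning = SetoidReasoning ≋-setoid

  %-≋ : ∀ x → x % n ≋ x
  %-≋ x = mk≋ (m%n%n≡m%n x n)

  multiple-+-≋ : ∀ t r → n * t + r ≋ r
  multiple-+-≋ t r = mk≋ (begin
    (n * t + r) % n ≡⟨ cong (_% n) (trans (+-comm (n * t) r) (cong (r +_) (*-comm n t))) ⟩
    (r + t * n) % n ≡⟨ [m+kn]%n≡m%n r t n ⟩
    r % n           ∎)
    where open ≡-Reasoning

  +-cong-≋ : ∀ {a b c e} → a ≋ b → c ≋ e → a + c ≋ b + e
  +-cong-≋ {a} {b} {c} {e} (mk≋ a≋b) (mk≋ c≋e) = mk≋ (begin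
    (a + c) % n             ≡⟨ %-distribˡ-+ a c n ⟩
    ((a % n) + (c % n)) % n ≡⟨ cong₂ (λ u v → (u + v) % n) a≋b c≋e ⟩
    ((b % n) + (e % n)) % n ≡⟨ %-distribˡ-+ b e n ⟨
    (b + e) % n             ∎)
    where open ≡-Reasoning

  *-cong-≋ : ∀ {a b c e} → a ≋ b → c ≋ e → a * c ≋ b * e
  *-cong-≋ {a} {b} {c} {e} (mk≋ a≋b) (mk≋ c≋e) = mk≋ (begin
    (a * c) % n             ≡⟨ %-distribˡ-* a c n ⟩
    ((a % n) * (c % n)) % n ≡⟨ cong₂ (λ u v → (u * v) % n) a≋b c≋e ⟩
    ((b % n) * (e % n)) % n ≡⟨ %-distribˡ-* b e n ⟨
    (b * e) % n             ∎)
    where open ≡-Reasoning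

  ^-one : ∀ {x} t → x ≋ 1 → x ^ t ≋ 1
  ^-one zero    _   = ≋-refl
  ^-one (suc t) x≋1 = *-cong-≋ x≋1 (^-one t x≋1)

module ZMod (q : ℕ) where
  open Residues (suc q)

  toℕ-⊕ : (a b : Fin (suc q)) → toℕ (a ⊕ b) ≡ (toℕ a + toℕ b) % suc q
  toℕ-⊕ a b = toℕ-fromℕ< _

  toℕ-⊕-≋ : (a b : Fin (suc q)) → toℕ (a ⊕ b) ≋ toℕ a + toℕ b
  toℕ-⊕-≋ a b = subst (_≋ toℕ a + toℕ b) (sym (toℕ-⊕ a b)) (%-≋ _)

  ≋⇒≡ : ∀ {a b : Fin (suc q)} → toℕ a ≋ toℕ b → a ≡ b
  ≋⇒≡ {a} {b} (mk≋ e) =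
    toℕ-injective (trans (sym (m<n⇒m%n≡m (toℕ<n a))) (trans e (m<n⇒m%n≡m (toℕ<n b))))

  ⊕-comm : (a b : Fin (suc q)) → a ⊕ b ≡ b ⊕ a
  ⊕-comm a b = ≋⇒≡ (begin
    toℕ (a ⊕ b)   ≈⟨ toℕ-⊕-≋ a b ⟩
    toℕ a + toℕ b ≡⟨ +-comm (toℕ a) (toℕ b) ⟩
    toℕ b + toℕ a ≈⟨ toℕ-⊕-≋ b a ⟨
    toℕ (b ⊕ a)   ∎)
    where open ≋-Reasoning

  ⊕-assoc : (a b c : Fin (suc q)) → (a ⊕ b) ⊕ c ≡ a ⊕ (b ⊕ c)
  ⊕-assoc a b c = ≋⇒≡ (begin
    toℕ ((a ⊕ b) ⊕ c)         ≈⟨ toℕ-⊕-≋ (a ⊕ b) c ⟩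
    toℕ (a ⊕ b) + toℕ c       ≈⟨ +-cong-≋ (toℕ-⊕-≋ a b) ≋-refl ⟩
    toℕ a + toℕ b + toℕ c     ≡⟨ +-assoc (toℕ a) (toℕ b) (toℕ c) ⟩
    toℕ a + (toℕ b + toℕ c)   ≈⟨ +-cong-≋ ≋-refl (toℕ-⊕-≋ b c) ⟨
    toℕ a + toℕ (b ⊕ c)       ≈⟨ toℕ-⊕-≋ a (b ⊕ c) ⟨
    toℕ (a ⊕ (b ⊕ c))         ∎)
    where open ≋-Reasoning

  ⊕-swap : (a b c : Fin (suc q)) → (a ⊕ b) ⊕ c ≡ (a ⊕ c) ⊕ b
  ⊕-swap a b c = begin
    (a ⊕ b) ⊕ c ≡⟨ ⊕-assoc a b c ⟩
    a ⊕ (b ⊕ c) ≡⟨ cong (a ⊕_) (⊕-comm b c) ⟩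
    a ⊕ (c ⊕ b) ≡⟨ ⊕-assoc a c b ⟨
    (a ⊕ c) ⊕ b ∎
    where open ≡-Reasoning

-- An injective endomap of a finite set is surjective: if y were missed,
-- punching y out of the codomain would inject Fin (suc n) into Fin n.
injective⇒surjective : ∀ {n} (f : Fin n → Fin n) → Injective _≡_ _≡_ f →
                       ∀ y → ∃ λ x → f x ≡ y
injective⇒surjective {suc n} f f-inj y with any? (λ x → f x ≟ᶠ y)
... | yes hit = hit
... | no miss = contradiction (injective⇒≤ punched-injective) (1+n≰n {n})
  where
  y≢f : ∀ x → y ≢ f x
  y≢f x y≡fx = miss (x , sym y≡fx)

  punched : Fin (suc n) → Fin n
  punched x = punchOut (y≢f x)

  punched-injective : Injective _≡_ _≡_ punched
  punched-injective {a} {b} eq = f-inj (punchOut-injective (y≢f a) (y≢f b) eq)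

findᵇ-satisfies : ∀ {A : Set} (P : A → Bool) (def : A) {x : A} (xs : List A) →
                  x ∈ xs → T (P x) → T (P (fromMaybe def (findᵇ P xs)))
findᵇ-satisfies P def (y ∷ ys) x∈ Px with P y in Py
... | true = subst T (sym Py) _
... | false with x∈
...   | here refl    = contradiction (subst T Py Px) id
...   | there x∈ys   = findᵇ-satisfies P def ys x∈ys Px

module PrimitiveRoot (q g : ℕ) (primRoot : IsPrimitiveRoot (suc (suc q)) g) where
  private
    m p : ℕ
    m = suc q
    p = suc m

  open Residues p
  open ≋-Reasoning
  open ZMod q using (toℕ-⊕)

  g^m≋1 : g ^ m ≋ 1
  g^m≋1 = mk≋ (proj₁ primRoot)

  inverse : ∀ {a} → a ≤ m → g ^ (m ∸ a) * g ^ a ≋ 1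
  inverse {a} a≤m = begin
    g ^ (m ∸ a) * g ^ a ≡⟨ ^-distribˡ-+-* g (m ∸ a) a ⟨
    g ^ (m ∸ a + a)     ≡⟨ cong (g ^_) (m∸n+n≡m a≤m) ⟩
    g ^ m               ≈⟨ g^m≋1 ⟩
    1                   ∎

  pow-mod : ∀ x → g ^ (x % m) ≋ g ^ x
  pow-mod x = begin
    g ^ (x % m)                       ≡⟨ *-identityʳ _ ⟨
    g ^ (x % m) * 1                   ≈⟨ *-cong-≋ (≋-refl {g ^ (x % m)}) (^-one (x / m) g^m≋1) ⟨
    g ^ (x % m) * (g ^ m) ^ (x / m)   ≡⟨ cong (g ^ (x % m) *_) (^-*-assoc g m (x / m)) ⟩
    g ^ (x % m) * g ^ (m * (x / m))   ≡⟨ ^-distribˡ-+-* g (x % m) _ ⟨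
    g ^ (x % m + m * (x / m))         ≡⟨ cong (g ^_) x%m+m*[x/m]≡x ⟩
    g ^ x                             ∎
    where
    x%m+m*[x/m]≡x : x % m + m * (x / m) ≡ x
    x%m+m*[x/m]≡x = trans (cong (x % m +_) (*-comm m (x / m))) (sym (m≡m%n+[m/n]*n x m))

  -- g^a ≋ g^(a + k) forces g^k ≋ 1 (multiply by the inverse of g^a)
  cancel : ∀ {a k} → a ≤ m → g ^ a ≋ g ^ (a + k) → g ^ k ≋ 1
  cancel {a} {k} a≤m h = begin
    g ^ k                         ≡⟨ *-identityˡ (g ^ k) ⟨
    1 * g ^ k                     ≈⟨ *-cong-≋ (inverse a≤m) ≋-refl ⟨
    g ^ (m ∸ a) * g ^ a * g ^ k   ≡⟨ *-assoc (g ^ (m ∸ a)) (g ^ a) (g ^ k) ⟩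
    g ^ (m ∸ a) * (g ^ a * g ^ k) ≡⟨ cong (g ^ (m ∸ a) *_) (^-distribˡ-+-* g a k) ⟨
    g ^ (m ∸ a) * g ^ (a + k)     ≈⟨ *-cong-≋ (≋-refl {g ^ (m ∸ a)}) h ⟨
    g ^ (m ∸ a) * g ^ a           ≈⟨ inverse a≤m ⟩
    1                             ∎

  powers-distinct : ∀ {a b} → a < b → b < m → ¬ (g ^ a ≋ g ^ b)
  powers-distinct {a} {b} a<b b<m h =
    proj₂ primRoot (b ∸ a) (m<n⇒0<n∸m a<b) (≤-<-trans (m∸n≤m b a) b<m)
      (residue (cancel (<⇒≤ (<-trans a<b b<m))
        (subst (λ e → g ^ a ≋ g ^ e) (sym (m+[n∸m]≡n (<⇒≤ a<b))) h)))

  pow-injective : ∀ {a b} → a < m → b < m → g ^ a ≋ g ^ b → a ≡ b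
  pow-injective {a} {b} a<m b<m h with <-cmp a b
  ... | tri< a<b _ _ = contradiction h (powers-distinct a<b b<m)
  ... | tri≈ _ a≡b _ = a≡b
  ... | tri> _ _ b<a = contradiction (≋-sym h) (powers-distinct b<a a<m)

  -- no power g^x (x ≤ m) is divisible by p, as it has an inverse
  pow-nonzero : ∀ {x} → x ≤ m → ¬ (g ^ x ≋ 0)
  pow-nonzero {x} x≤m h = 0≢1+n (residue (begin
    0                   ≡⟨ *-zeroʳ (g ^ (m ∸ x)) ⟨
    g ^ (m ∸ x) * 0     ≈⟨ *-cong-≋ (≋-refl {g ^ (m ∸ x)}) h ⟨
    g ^ (m ∸ x) * g ^ x ≈⟨ inverse x≤m ⟩
    1                   ∎))

  IsLog : ℕ → Fin m → Set
  IsLog x e = g ^ toℕ e ≋ x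

  log-one : IsLog 1 zero
  log-one = ≋-refl

  log-unique : ∀ {x e₁ e₂} → IsLog x e₁ → IsLog x e₂ → e₁ ≡ e₂
  log-unique {e₁ = e₁} {e₂} h₁ h₂ =
    toℕ-injective (pow-injective (toℕ<n e₁) (toℕ<n e₂) (≋-trans h₁ (≋-sym h₂)))

  log-mul : ∀ {a b e₁ e₂} → IsLog a e₁ → IsLog b e₂ → IsLog (a * b) (e₁ ⊕ e₂)
  log-mul {a} {b} {e₁} {e₂} h₁ h₂ = begin
    g ^ toℕ (e₁ ⊕ e₂)           ≡⟨ cong (g ^_) (toℕ-⊕ e₁ e₂) ⟩
    g ^ ((toℕ e₁ + toℕ e₂) % m) ≈⟨ pow-mod (toℕ e₁ + toℕ e₂) ⟩
    g ^ (toℕ e₁ + toℕ e₂)       ≡⟨ ^-distribˡ-+-* g (toℕ e₁) (toℕ e₂) ⟩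
    g ^ toℕ e₁ * g ^ toℕ e₂     ≈⟨ *-cong-≋ h₁ h₂ ⟩
    a * b                       ∎

  -- e ↦ (g^e mod p) - 1, an injective self-map of Fin m
  shifted-power : Fin m → Fin m
  shifted-power e =
    fromℕ< (≤-<-trans (∸-monoˡ-≤ 1 (s≤s⁻¹ (m%n<n (g ^ toℕ e) p))) (n<1+n q))

  positive-power : ∀ e → 1 ≤ g ^ toℕ e % p
  positive-power e = n≢0⇒n>0 (pow-nonzero (<⇒≤ (toℕ<n e)) ∘ mk≋)

  shifted-power-injective : Injective _≡_ _≡_ shifted-power
  shifted-power-injective {a} {b} eq =
    toℕ-injective (pow-injective (toℕ<n a) (toℕ<n b) (mk≋
      (∸-cancelʳ-≡ (positive-power a) (positive-power b)
        (trans (sym (toℕ-fromℕ< _)) (trans (cong toℕ eq) (toℕ-fromℕ< _))))))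

  unit-has-log : ∀ {r} → r < m → ∃ (IsLog (suc r))
  unit-has-log {r} r<m with injective⇒surjective shifted-power shifted-power-injective (fromℕ< r<m)
  ... | e , hit = e , mk≋ (trans residue≡ (sym (m<n⇒m%n≡m (s≤s r<m))))
    where
    residue≡ : g ^ toℕ e % p ≡ suc r
    residue≡ = ∸-cancelʳ-≡ (positive-power e) (s≤s z≤n)
      (trans (sym (toℕ-fromℕ< _)) (trans (cong toℕ hit) (toℕ-fromℕ< r<m)))

  dlog-isLog : ∀ {x} def → ∃ (IsLog x) → IsLog x (dlog p g x def)
  dlog-isLog {x} def (e , mk≋ ge≋x) =
    mk≋ (≡ᵇ⇒≡ _ _ (findᵇ-satisfies test def (allFin m) (∈-allFin e) (≡⇒≡ᵇ _ _ ge≋x)))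
    where
    test : Fin m → Bool
    test e′ = g ^ toℕ e′ % p ≡ᵇ x % p

letter-injective : ∀ {m} {a b : Fin m} → letter {m} a ≡ letter b → a ≡ b
letter-injective refl = refl

fill-letter : ∀ {m} (x y : Word m) {n a} → x n ≡ letter a → (x ⟨ y ⟩) n ≡ letter a
fill-letter x y xn≡a rewrite xn≡a = refl

fill-gap : ∀ {m} (x y : Word m) {n f} → x n ≡ gap f →
           (x ⟨ y ⟩) n ≡ plug f (y (gapCount x n))
fill-gap x y xn≡f rewrite xn≡f = refl

isGap≤1 : ∀ {m} (s : Sym m) → isGap s ≤ 1
isGap≤1 (letter _) = z≤n
isGap≤1 (gap _)    = s≤s z≤n

-- in a word starting with a letter, a gap at position j is preceded by
-- fewer than j gaps; this makes the recursion defining T(P) well founded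
gapCount<position : ∀ {m} (x : Word m) {a} → x 0 ≡ letter a →
                    ∀ {j f} → x j ≡ gap f → gapCount x j < j
gapCount<position x x0≡a {zero}  x0≡f = contradiction (trans (sym x0≡a) x0≡f) λ ()
gapCount<position x x0≡a {suc j} _    = s≤s (before j)
  where
  before : ∀ j → gapCount x (suc j) ≤ j
  before zero    rewrite x0≡a = z≤n
  before (suc j) = ≤-trans (+-mono-≤ (before j) (isGap≤1 (x (suc j))))
                           (≤-reflexive (+-comm j 1))

EventuallyLetter : ∀ {m} → List (Sym m) → ℕ → Fin m → Set
EventuallyLetter P j a = ∃ λ i₀ → ∀ i → i₀ ≤ i → Tseq P i j ≡ letter a

eventually-unique : ∀ {m} {P : List (Sym m)} {j a b} →
                    EventuallyLetter P j a → EventuallyLetter P j b → a ≡ b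
eventually-unique (i₀ , h) (i₁ , h′) =
  letter-injective (trans (sym (h (i₀ + i₁) (m≤m+n i₀ i₁))) (h′ (i₀ + i₁) (m≤n+m i₁ i₀)))

eventually-at-letter : ∀ {m} (P : List (Sym m)) {j a} → (P ω) j ≡ letter a →
                       EventuallyLetter P j a
eventually-at-letter P eq = 1 , λ { (suc i) _ → fill-letter (P ω) (Tseq P i) eq }

eventually-at-gap : ∀ {m} (P : List (Sym m)) {j f a} → (P ω) j ≡ gap f →
                    EventuallyLetter P (gapCount (P ω) j) a → EventuallyLetter P j (f a)
eventually-at-gap P eq (i₀ , h) =
  suc i₀ , λ { (suc i) (s≤s i₀≤i) → trans (fill-gap (P ω) (Tseq P i) eq) (cong (plug _) (h i i₀≤i)) }

toeplitz-exists : ∀ {m} (P : List (Sym m)) {a} → (P ω) 0 ≡ letter a →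
                  ∃ (IsToeplitzWord P)
toeplitz-exists P first = (λ n → proj₁ (stable (n ∸ 1))) , (λ n _ → proj₂ (stable (n ∸ 1)))
  where
  step : ∀ j → (∀ {k} → k < j → ∃ (EventuallyLetter P k)) → ∃ (EventuallyLetter P j)
  step j stable-below with (P ω) j in eq
  ... | letter b = b , eventually-at-letter P eq
  ... | gap f with stable-below (gapCount<position (P ω) first eq)
  ...   | a , lim = f a , eventually-at-gap P eq lim

  stable : ∀ j → ∃ (EventuallyLetter P j)
  stable = <-rec _ step

module ToeplitzWord {m} (P : List (Sym m)) (w : ℕ → Fin m) (tw : IsToeplitzWord P w) where

  limit : ∀ j → EventuallyLetter P j (w (suc j))
  limit j = tw (suc j) (s≤s z≤n)

  at-letter : ∀ {j a} → (P ω) j ≡ letter a → w (suc j) ≡ a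
  at-letter eq = eventually-unique (limit _) (eventually-at-letter P eq)

  at-gap : ∀ {j f} → (P ω) j ≡ gap f → w (suc j) ≡ f (w (suc (gapCount (P ω) j)))
  at-gap eq = eventually-unique (limit _) (eventually-at-gap P eq (limit _))

lookup-snoc : ∀ {A B : Set} k (h : Fin k → B) (f : B → A) (y : A)
              (i : Fin (length (map f (tabulate h) ++ y ∷ []))) →
              (∃ λ j → toℕ j ≡ toℕ i × lookup (map f (tabulate h) ++ y ∷ []) i ≡ f (h j)) ⊎
              (toℕ i ≡ k × lookup (map f (tabulate h) ++ y ∷ []) i ≡ y)
lookup-snoc zero    h f y zero    = inj₂ (refl , refl)
lookup-snoc (suc k) h f y zero    = inj₁ (zero , refl , refl)
lookup-snoc (suc k) h f y (suc i) with lookup-snoc k (h ∘ suc) f y i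
... | inj₁ (j , j≡i , entry) = inj₁ (suc j , cong suc j≡i , entry)
... | inj₂ (i≡k , entry)     = inj₂ (cong suc i≡k , entry)

module LambdaRho (q g : ℕ) (primRoot : IsPrimitiveRoot (suc (suc q)) g) (d : Fin (suc q)) where
  private
    m p : ℕ
    m = suc q
    p = suc m

  open Residues p
  open PrimitiveRoot q g primRoot

  Pat : List (Sym m)
  Pat = pattern-λρ p g d

  letterOf : Fin m → Sym m
  letterOf i = letter (dlog p g (suc (toℕ i)) i)

  length-Pat : length Pat ≡ p
  length-Pat = begin
    length (map letterOf (allFin m) ++ gap (ρ d) ∷ []) ≡⟨ length-++ (map letterOf (allFin m)) ⟩
    length (map letterOf (allFin m)) + 1               ≡⟨ cong (_+ 1) (trans (length-map letterOf (allFin m)) (length-tabulate id)) ⟩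
    m + 1                                              ≡⟨ +-comm m 1 ⟩
    p                                                  ∎
    where open ≡-Reasoning

  ω-lookup : ∀ j → ∃ λ (i : Fin (length Pat)) → toℕ i ≡ j % p × (Pat ω) j ≡ lookup Pat i
  ω-lookup j = j mod _ , trans (toℕ-fromℕ< _) (%-congʳ {o = j} length-Pat) , refl

  pattern-letter : ∀ j → j % p < m → ∃ λ e → IsLog (suc (j % p)) e × (Pat ω) j ≡ letter e
  pattern-letter j r<m with ω-lookup j
  ... | i , i≡r , eq with lookup-snoc m id letterOf (gap (ρ d)) i
  ...   | inj₂ (i≡m , _) = contradiction (trans (sym i≡r) i≡m) (<⇒≢ r<m)
  ...   | inj₁ (k , k≡i , entry) =
          e , subst (λ r → IsLog (suc r) e) (trans k≡i i≡r) e-isLog , trans eq entry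
    where
    e : Fin m
    e = dlog p g (suc (toℕ k)) k
    e-isLog : IsLog (suc (toℕ k)) e
    e-isLog = dlog-isLog k (unit-has-log (toℕ<n k))

  pattern-gap : ∀ j → j % p ≡ m → (Pat ω) j ≡ gap (ρ d)
  pattern-gap j r≡m with ω-lookup j
  ... | i , i≡r , eq with lookup-snoc m id letterOf (gap (ρ d)) i
  ...   | inj₁ (k , k≡i , _) = contradiction (trans (trans k≡i i≡r) r≡m) (<⇒≢ (toℕ<n k))
  ...   | inj₂ (_ , entry)   = trans eq entry

  starts-with-letter : ∃ λ a → (Pat ω) 0 ≡ letter a
  starts-with-letter with pattern-letter 0 (s≤s z≤n)
  ... | e , _ , eq = e , eq

  position-residue : ∀ t r → r < p → (p * t + r) % p ≡ r
  position-residue t r r<p = trans (residue (multiple-+-≋ t r)) (m<n⇒m%n≡m r<p)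

  p*[1+t] : ∀ t → p * suc t ≡ suc (p * t + m)
  p*[1+t] t = trans (*-suc p t) (cong suc (+-comm m (p * t)))

  -- one gap per period: exactly t gaps precede position p t + r (r ≤ m)
  gapCount-Pat : ∀ t r → r ≤ m → gapCount (Pat ω) (p * t + r) ≡ t
  gapCount-Pat zero    zero    _   = cong (gapCount (Pat ω)) (trans (+-identityʳ (p * 0)) (*-zeroʳ p))
  gapCount-Pat (suc t) zero    _   = begin
    gapCount (Pat ω) (p * suc t + 0)                            ≡⟨ cong (gapCount (Pat ω)) (trans (+-identityʳ _) (p*[1+t] t)) ⟩
    gapCount (Pat ω) (p * t + m) + isGap ((Pat ω) (p * t + m))  ≡⟨ cong₂ _+_ (gapCount-Pat t m ≤-refl) (cong isGap gap-at-end) ⟩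
    t + 1                                                       ≡⟨ +-comm t 1 ⟩
    suc t                                                       ∎
    where
    open ≡-Reasoning
    gap-at-end : (Pat ω) (p * t + m) ≡ gap (ρ d)
    gap-at-end = pattern-gap (p * t + m) (position-residue t m (n<1+n m))
  gapCount-Pat t       (suc r) r<m = begin
    gapCount (Pat ω) (p * t + suc r)                            ≡⟨ cong (gapCount (Pat ω)) (+-suc (p * t) r) ⟩
    gapCount (Pat ω) (p * t + r) + isGap ((Pat ω) (p * t + r))  ≡⟨ cong₂ _+_ (gapCount-Pat t r (<⇒≤ r<m)) (cong isGap (proj₂ (proj₂ letter-at-r))) ⟩
    t + 0                                                       ≡⟨ +-identityʳ t ⟩
    t                                                           ∎
    where
    open ≡-Reasoning
    letter-at-r : ∃ λ e → IsLog (suc ((p * t + r) % p)) e × (Pat ω) (p * t + r) ≡ letter e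
    letter-at-r = pattern-letter (p * t + r)
      (subst (_< m) (sym (position-residue t r (m<n⇒m<1+n r<m))) r<m)

  module _ (w : ℕ → Fin m) (tw : IsToeplitzWord Pat w) where
    open ToeplitzWord Pat w tw

    unit-values : ∀ n → ¬ (p ∣ n) → IsLog n (w n)
    unit-values zero    p∤0 = contradiction (p ∣0) p∤0
    unit-values (suc j) p∤n with m≤n⇒m<n∨m≡n (s≤s⁻¹ (m%n<n j p))
    ... | inj₂ r≡m = contradiction (divides (suc (j / p)) 1+j≡[1+j/p]*p) p∤n
      where
      1+j≡[1+j/p]*p : suc j ≡ suc (j / p) * p
      1+j≡[1+j/p]*p = cong suc (trans (m≡m%n+[m/n]*n j p) (cong (_+ j / p * p) r≡m))
    ... | inj₁ r<m with pattern-letter j r<m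
    ...   | e , log , eq =
            subst (IsLog (suc j)) (sym (at-letter eq)) (≋-trans log (+-cong-≋ (≋-refl {1}) (%-≋ j)))

    multiple-values : ∀ t → w (p * suc t) ≡ w (suc t) ⊕ d
    multiple-values t = begin
      w (p * suc t)                                ≡⟨ cong w (p*[1+t] t) ⟩
      w (suc (p * t + m))                          ≡⟨ at-gap (pattern-gap (p * t + m) (position-residue t m (n<1+n m))) ⟩
      ρ d (w (suc (gapCount (Pat ω) (p * t + m)))) ≡⟨ cong (λ k → ρ d (w (suc k))) (gapCount-Pat t m ≤-refl) ⟩
      w (suc t) ⊕ d                                ∎
      where open ≡-Reasoning

module Additivity (q g : ℕ) (primRoot : IsPrimitiveRoot (suc (suc q)) g)
  (p-prime : Prime (suc (suc q))) (d : Fin (suc q)) (σ : ℕ → Fin (suc q))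
  (σ-unit : ∀ n → ¬ (suc (suc q) ∣ n) → PrimitiveRoot.IsLog q g primRoot n (σ n))
  (σ-multiple : ∀ t → σ (suc (suc q) * suc t) ≡ σ (suc t) ⊕ d) where
  private
    m p : ℕ
    m = suc q
    p = suc m

  open PrimitiveRoot q g primRoot
  open ZMod q using (⊕-comm; ⊕-swap)
  open ≡-Reasoning

  data UnitOrMultiple (n : ℕ) : Set where
    unit     : ¬ (p ∣ n) → UnitOrMultiple n
    multiple : ∀ t → n ≡ p * suc t → UnitOrMultiple n

  unit-or-multiple : ∀ n → 1 ≤ n → UnitOrMultiple n
  unit-or-multiple n 1≤n with p ∣? n
  ... | no p∤n                 = unit p∤n
  ... | yes (divides zero n≡0) = contradiction (subst (1 ≤_) n≡0 1≤n) λ ()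
  ... | yes (divides (suc t) n≡[1+t]p) = multiple t (trans n≡[1+t]p (*-comm (suc t) p))

  σ-one : toℕ (σ 1) ≡ 0
  σ-one = cong toℕ (log-unique {e₁ = σ 1} {e₂ = zero} (σ-unit 1 p∤1) log-one)
    where
    p∤1 : ¬ (p ∣ 1)
    p∤1 p∣1 = contradiction (∣1⇒≡1 p∣1) λ ()

  peel-multiple : ∀ t k → 1 ≤ k → σ (suc t * k) ≡ σ (suc t) ⊕ σ k →
                  σ (p * suc t * k) ≡ σ (p * suc t) ⊕ σ k
  peel-multiple t (suc k) _ additive = begin
    σ (p * suc t * suc k)       ≡⟨ cong σ (*-assoc p (suc t) (suc k)) ⟩
    σ (p * (suc t * suc k))     ≡⟨ σ-multiple (k + t * suc k) ⟩
    σ (suc t * suc k) ⊕ d       ≡⟨ cong (_⊕ d) additive ⟩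
    (σ (suc t) ⊕ σ (suc k)) ⊕ d ≡⟨ ⊕-swap (σ (suc t)) (σ (suc k)) d ⟩
    (σ (suc t) ⊕ d) ⊕ σ (suc k) ≡⟨ cong (_⊕ σ (suc k)) (σ-multiple t) ⟨
    σ (p * suc t) ⊕ σ (suc k)   ∎

  smaller : ∀ {N} t k → p * suc t + k ≤ suc N → suc t + k ≤ N
  smaller t k bound = s≤s⁻¹ (<-≤-trans (+-monoˡ-< k (m<m+n (suc t) (s≤s z≤n))) bound)

  additive-below : ∀ N n k → n + k ≤ N → 1 ≤ n → 1 ≤ k → σ (n * k) ≡ σ n ⊕ σ k
  additive-below zero    (suc _) _ () _ _
  additive-below (suc N) n k bound 1≤n 1≤k with unit-or-multiple n 1≤n | unit-or-multiple k 1≤k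
  ... | multiple t refl | _ =
        peel-multiple t k 1≤k (additive-below N (suc t) k (smaller t k bound) (s≤s z≤n) 1≤k)
  ... | unit _ | multiple t refl = begin
        σ (n * (p * suc t))  ≡⟨ cong σ (*-comm n (p * suc t)) ⟩
        σ (p * suc t * n)    ≡⟨ peel-multiple t n 1≤n (additive-below N (suc t) n bound′ (s≤s z≤n) 1≤n) ⟩
        σ (p * suc t) ⊕ σ n  ≡⟨ ⊕-comm (σ (p * suc t)) (σ n) ⟩
        σ n ⊕ σ (p * suc t)  ∎
    where
    bound′ : suc t + n ≤ N
    bound′ = smaller t n (subst (_≤ suc N) (+-comm n (p * suc t)) bound)
  ... | unit p∤n | unit p∤k =
        log-unique (σ-unit (n * k) p∤nk) (log-mul {e₁ = σ n} {e₂ = σ k} (σ-unit n p∤n) (σ-unit k p∤k))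
    where
    p∤nk : ¬ (p ∣ n * k)
    p∤nk p∣nk = [ p∤n , p∤k ]′ (euclidsLemma n k p-prime p∣nk)

  completely-additive : CompletelyAdditive σ
  completely-additive = σ-one , λ n k → additive-below (n + k) n k ≤-refl

mainTheorem16 : (p g : ℕ) → Prime p → IsPrimitiveRoot p g → (p ≡ 2 → g ≡ 1) →
    (d : Fin (p ∸ 1)) →
    (∃ λ w → IsToeplitzWord (pattern-λρ p g d) w) ×
    (∀ w → IsToeplitzWord (pattern-λρ p g d) w → CompletelyAdditive w)
mainTheorem16 zero          _ p-prime = contradiction p-prime ¬prime[0]
mainTheorem16 (suc zero)    _ p-prime = contradiction p-prime ¬prime[1]
mainTheorem16 (suc (suc q)) g p-prime primRoot _ d =
  toeplitz-exists Pat (proj₂ starts-with-letter) ,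
  λ w tw → Additivity.completely-additive q g primRoot p-prime d w
             (unit-values w tw) (multiple-values w tw)
  where open LambdaRho q g primRoot d
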